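{- Let $m,l\ge0$ and $k\ge1$ be integers. Then for every $n\ge1$, \[ f_{v_{m,l}}(n+1,k)-f_{v_{m,l}}(n,k)=\sum_{j=0}^{m+l-1}\binom{n}{j}f_{v_{m,l}}(n+1-j,k-1). \]
   Context: For integers $k,n\ge 0$, a word is an element of $[k]^n$, where $[k]=\{1,\dots,k\}$ is totally ordered. A word $\sigma\in[k]^n$ contains a word $\tau$ of length $p$ if there are indices $1\le i_1<\dots<i_p\le n$ such that for all $1\le a,b\le p$ and each relation $\phi\in\{<,=,>\}$, $\sigma(i_a)\,\phi\,\sigma(i_b)$ holds iff $\tau(a)\,\phi\,\tau(b)$ holds; otherwise $\sigma$ avoids $\tau$. For $m,l\ge0$, $v_{m,l}$ denotes the word consisting of $m$ copies of $1$, followed by one letter $2$, followed by $l$ copies of $1$. $f_{v_{m,l}}(n,k)$ is the number of words in $[k]^n$ avoiding $v_{m,l}$. -}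

module Defs where

open import Data.Nat using (ℕ; zero; suc; _+_; _*_; _∸_; _≡ᵇ_; _<ᵇ_)
open import Data.Fin using (Fin; toℕ)
open import Data.Bool using (Bool; true; false; _∧_; not; if_then_else_)
open import Data.List using (List; []; _∷_; _++_; [_]; replicate; map; concatMap; length; filterᵇ; allFin)
open import Data.Bool.ListAction using (all; any)
open import Data.Product using (_×_; _,_)
open import Data.List using (zip)

data Rel3 : Set where
  lt eq gt : Rel3

cmp : ℕ → ℕ → Rel3
cmp a b = if a <ᵇ b then lt else (if a ≡ᵇ b then eq else gt)

sameRel : Rel3 → Rel3 → Bool
sameRel lt lt = true
sameRel eq eq = true
sameRel gt gt = true
sameRel _  _  = false

-- All words of [k]^n, letters Fin k (Fin k ≅ [k] order-preservingly via toℕ).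
words : (k n : ℕ) → List (List (Fin k))
words k zero    = [] ∷ []
words k (suc n) = concatMap (λ a → map (a ∷_) (words k n)) (allFin k)

subseqs : {A : Set} → List A → List (List A)
subseqs []       = [] ∷ []
subseqs (x ∷ xs) = map (x ∷_) (subseqs xs) ++ subseqs xs

orderIso : List ℕ → List ℕ → Bool
orderIso s t = (length s ≡ᵇ length t) ∧
  all (λ p → all (λ q → pairOK p q) ps) ps
  where
  ps = zip s t
  pairOK : ℕ × ℕ → ℕ × ℕ → Bool
  pairOK (x , a) (y , b) = sameRel (cmp x y) (cmp a b)

contains : {k : ℕ} → List (Fin k) → List ℕ → Bool
contains σ τ = any (λ s → orderIso (map toℕ s) τ) (subseqs σ)

v : ℕ → ℕ → List ℕ
v m l = replicate m 1 ++ [ 2 ] ++ replicate l 1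

f : List ℕ → ℕ → ℕ → ℕ
f τ n k = length (filterᵇ (λ σ → not (contains σ τ)) (words k n))

module Submission where

-- Split a word over [k+1] into its shape, recording which positions carry the smallest
-- letter, and its strip, the word over [k] formed by the other letters lowered by one.
-- An occurrence of v_{m,l} either avoids the smallest letter, and is then an occurrence in
-- the strip, or has the smallest letter as its repeated letter, which happens exactly when
-- some other letter has at least m smallest letters before it and at least l after it.
-- Hence f(n,k+1) is a sum of f(j,k) over the admissible shapes of length n with j
-- non-smallest letters. Splitting shapes by their first letter and inducting on m, with
-- Pascal's rule, reduces f(n+1,k+1) - f(n,k+1) to the case m = 0, where it counts the shapes
-- that start with a larger letter followed by fewer than l smallest letters. When
-- m = l = 0 every nonempty word contains v, and both sides vanish.

open import Defs
open import Data.Nat using (ℕ; zero; suc; _+_; _*_; _∸_; _≤_; _<_; _<ᵇ_; _≡ᵇ_; z≤n; s≤s; z<s; s<s)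
open import Data.Nat.Properties
open import Data.Nat.Combinatorics using (_C_; k>n⇒nCk≡0; nCk+nC[k+1]≡[n+1]C[k+1])
open import Data.Nat.ListAction using (sum)
open import Data.Fin using (Fin; zero; suc; toℕ)
open import Data.Bool using (Bool; true; false; _∧_; not; if_then_else_; T; T?)
open import Data.Bool.Properties using (T-≡; T-∧)
open import Data.Bool.ListAction using (all)
open import Data.Product using (_×_; _,_; proj₁; proj₂; ∃-syntax; ∃₂)
open import Data.Sum using (_⊎_; inj₁; inj₂)
open import Data.Empty using (⊥-elim)
open import Data.List
  using (List; []; _∷_; _++_; map; concatMap; upTo; allFin; length; filterᵇ; replicate; zip)
open import Data.List.Properties
  using ( map-cong; map-applyUpTo; map-tabulate; map-++; map-replicate; map-∘; length-++
        ; length-replicate; filter-++; filter-none; zipWith-replicate; ∷-injectiveʳ )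
open import Data.List.Relation.Unary.All using (All; []; _∷_)
import Data.List.Relation.Unary.All as All
open import Data.List.Relation.Unary.All.Properties using (all⁺; all⁻; ++⁺; replicate⁺)
open import Data.List.Relation.Unary.Any using (Any; here)
import Data.List.Relation.Unary.Any.Properties as Any
open import Data.List.Relation.Binary.Sublist.Propositional using (_⊆_; []; _∷_; _∷ʳ_; minimum)
open import Data.List.Relation.Binary.Sublist.Propositional.Properties using (map⁺)
open import Function using (_∘_; id)
open import Function.Bundles using (module Equivalence)
open Equivalence using (to; from)
open import Relation.Nullary using (¬_; yes; no)
open import Relation.Nullary.Reflects using (ofʸ; ofⁿ)
open import Relation.Binary.PropositionalEquality
open import Algebra.Properties.CommutativeSemigroup +-commutativeSemigroup
  using (x∙yz≈y∙xz; interchange)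

private
  variable
    A B : Set

∑∈ : List A → (A → ℕ) → ℕ
∑∈ xs g = sum (map g xs)

infix 5 ∑∈
syntax ∑∈ xs (λ x → e) = ∑[ x ∈ xs ] e

∑-cong : ∀ (xs : List A) {g h : A → ℕ} → (∀ x → g x ≡ h x) → ∑∈ xs g ≡ ∑∈ xs h
∑-cong xs g≗h = cong sum (map-cong g≗h xs)

∑-zero : ∀ (xs : List A) {g : A → ℕ} → (∀ x → g x ≡ 0) → ∑∈ xs g ≡ 0
∑-zero []       g≗0 = refl
∑-zero (x ∷ xs) g≗0 = cong₂ _+_ (g≗0 x) (∑-zero xs g≗0)

∑-distrib-+ : ∀ (xs : List A) (g h : A → ℕ) →
  ∑[ x ∈ xs ] (g x + h x) ≡ ∑∈ xs g + ∑∈ xs h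
∑-distrib-+ []       g h = refl
∑-distrib-+ (x ∷ xs) g h =
  trans (cong (g x + h x +_) (∑-distrib-+ xs g h)) (interchange (g x) (h x) _ _)

∑-if : ∀ (xs : List A) c (h : A → ℕ) →
  ∑[ x ∈ xs ] (if c then h x else 0) ≡ (if c then ∑∈ xs h else 0)
∑-if xs true  h = refl
∑-if xs false h = ∑-zero xs (λ _ → refl)

∑-upTo-suc : ∀ n (g : ℕ → ℕ) → ∑[ j ∈ upTo (suc n) ] g j ≡ g 0 + (∑[ j ∈ upTo n ] g (suc j))
∑-upTo-suc n g =
  cong (λ js → g 0 + sum js) (trans (map-applyUpTo suc g n) (sym (map-applyUpTo id (g ∘ suc) n)))

∑-allFin-suc : ∀ k (h : Fin (suc k) → ℕ) →
  ∑[ i ∈ allFin (suc k) ] h i ≡ h zero + (∑[ i ∈ allFin k ] h (suc i))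
∑-allFin-suc k h =
  cong (λ xs → h zero + sum xs) (trans (map-tabulate suc h) (sym (map-tabulate id (h ∘ suc))))

∑-pascal : ∀ N M (ψ : ℕ → ℕ) →
  (∑[ z ∈ upTo M ] (N C z) * ψ (suc z)) + (∑[ z ∈ upTo (suc M) ] (N C z) * ψ z)
    ≡ ∑[ z ∈ upTo (suc M) ] (suc N C z) * ψ z
∑-pascal N M ψ = begin
  X + (∑[ z ∈ upTo (suc M) ] (N C z) * ψ z)  ≡⟨ cong (X +_) (∑-upTo-suc M (λ z → (N C z) * ψ z)) ⟩
  X + (ψ 0 + 0 + Y)                         ≡⟨ x∙yz≈y∙xz X (ψ 0 + 0) Y ⟩
  ψ 0 + 0 + (X + Y)                         ≡⟨ cong (ψ 0 + 0 +_) (sym (∑-distrib-+ (upTo M) _ _)) ⟩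
  ψ 0 + 0 + (∑[ z ∈ upTo M ] ((N C z) * ψ (suc z) + (N C suc z) * ψ (suc z)))
    ≡⟨ cong (ψ 0 + 0 +_) (∑-cong (upTo M) pascal) ⟩
  ψ 0 + 0 + (∑[ z ∈ upTo M ] (suc N C suc z) * ψ (suc z))
    ≡⟨ ∑-upTo-suc M (λ z → (suc N C z) * ψ z) ⟨
  ∑[ z ∈ upTo (suc M) ] (suc N C z) * ψ z     ∎
  where
  open ≡-Reasoning
  X = ∑[ z ∈ upTo M ] (N C z) * ψ (suc z)
  Y = ∑[ z ∈ upTo M ] (N C suc z) * ψ (suc z)
  pascal : ∀ z → (N C z) * ψ (suc z) + (N C suc z) * ψ (suc z) ≡ (suc N C suc z) * ψ (suc z)
  pascal z = trans (sym (*-distribʳ-+ (ψ (suc z)) (N C z) (N C suc z)))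
                   (cong (_* ψ (suc z)) (nCk+nC[k+1]≡[n+1]C[k+1] N z))

-- The two sides can only differ when j > n + 1, where n C j = 0.
C-*-suc-∸ : ∀ n j (φ : ℕ → ℕ) → (n C j) * φ (suc (suc n ∸ j)) ≡ (n C j) * φ (suc (suc n) ∸ j)
C-*-suc-∸ n j φ with j ≤? n
... | yes j≤n = cong (λ i → (n C j) * φ i) (sym (+-∸-assoc 1 (m≤n⇒m≤1+n j≤n)))
... | no  j≰n rewrite k>n⇒nCk≡0 (≰⇒> j≰n) = refl

-- v m l is definitionally motif m l 1 2.
motif : ℕ → ℕ → A → A → List A
motif m l x y = replicate m x ++ y ∷ replicate l x

map-motif : ∀ (f : A → B) m l x y → map f (motif m l x y) ≡ motif m l (f x) (f y)
map-motif f m l x y = trans (map-++ f (replicate m x) _)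
  (cong₂ (λ xs ys → xs ++ f y ∷ ys) (map-replicate f m x) (map-replicate f l x))

length-motif : ∀ m l (x y : A) → length (motif m l x y) ≡ m + suc l
length-motif m l x y =
  trans (length-++ (replicate m x)) (cong₂ _+_ (length-replicate m) (cong suc (length-replicate l)))

zip-motif : ∀ m l (x y : A) (x' y' : B) →
  zip (motif m l x y) (motif m l x' y') ≡ motif m l (x , x') (y , y')
zip-motif (suc m) l x y x' y' = cong ((x , x') ∷_) (zip-motif m l x y x' y')
zip-motif zero    l x y x' y' = cong ((y , y') ∷_) (zipWith-replicate l _,_ x x')

all-motif : ∀ (p : A → Bool) m l {x y} → T (p x) → T (p y) → T (all p (motif m l x y))
all-motif p m l px py = all⁻ p (++⁺ (replicate⁺ m px) (py ∷ replicate⁺ l px))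

-- Shapes

∑shapes : ℕ → (List Bool → ℕ) → ℕ
∑shapes zero    h = h []
∑shapes (suc N) h = ∑shapes N (h ∘ (false ∷_)) + ∑shapes N (h ∘ (true ∷_))

∑shapes-cong : ∀ N {h h' : List Bool → ℕ} → (∀ s → length s ≡ N → h s ≡ h' s) →
  ∑shapes N h ≡ ∑shapes N h'
∑shapes-cong zero    h≗h' = h≗h' [] refl
∑shapes-cong (suc N) h≗h' = cong₂ _+_ (∑shapes-cong N (λ s p → h≗h' (false ∷ s) (cong suc p)))
                                      (∑shapes-cong N (λ s p → h≗h' (true ∷ s) (cong suc p)))

∑shapes-zero : ∀ N → ∑shapes N (λ _ → 0) ≡ 0
∑shapes-zero zero    = refl
∑shapes-zero (suc N) = cong₂ _+_ (∑shapes-zero N) (∑shapes-zero N)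

∑-∑shapes-comm : ∀ (xs : List A) N (h : A → List Bool → ℕ) →
  ∑[ x ∈ xs ] ∑shapes N (h x) ≡ ∑shapes N (λ s → ∑[ x ∈ xs ] h x s)
∑-∑shapes-comm xs zero    h = refl
∑-∑shapes-comm xs (suc N) h = trans (∑-distrib-+ xs _ _)
  (cong₂ _+_ (∑-∑shapes-comm xs N (λ x s → h x (false ∷ s)))
             (∑-∑shapes-comm xs N (λ x s → h x (true ∷ s))))

zeros : List Bool → ℕ
zeros []          = 0
zeros (false ∷ s) = suc (zeros s)
zeros (true ∷ s)  = zeros s

ones : List Bool → ℕ
ones []          = 0
ones (false ∷ s) = ones s
ones (true ∷ s)  = suc (ones s)

ones+zeros≡length : ∀ s → ones s + zeros s ≡ length s
ones+zeros≡length []          = refl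
ones+zeros≡length (false ∷ s) = trans (+-suc (ones s) (zeros s)) (cong suc (ones+zeros≡length s))
ones+zeros≡length (true ∷ s)  = cong suc (ones+zeros≡length s)

suc-ones≡∸zeros : ∀ s → suc (ones s) ≡ suc (length s) ∸ zeros s
suc-ones≡∸zeros s = begin
  suc (ones s)                     ≡⟨ m+n∸n≡m (suc (ones s)) (zeros s) ⟨
  suc (ones s + zeros s) ∸ zeros s ≡⟨ cong (λ n → suc n ∸ zeros s) (ones+zeros≡length s) ⟩
  suc (length s) ∸ zeros s         ∎
  where open ≡-Reasoning

∑shapes-binomial : ∀ N l (ψ : ℕ → ℕ) →
  ∑shapes N (λ s → if zeros s <ᵇ l then ψ (zeros s) else 0) ≡ ∑[ z ∈ upTo l ] (N C z) * ψ z
∑shapes-binomial zero    zero    ψ = refl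
∑shapes-binomial zero    (suc l) ψ = sym (begin
  ∑[ z ∈ upTo (suc l) ] (0 C z) * ψ z ≡⟨ ∑-upTo-suc l (λ z → (0 C z) * ψ z) ⟩
  ψ 0 + 0 + (∑[ z ∈ upTo l ] 0)       ≡⟨ cong₂ _+_ (+-identityʳ (ψ 0)) (∑-zero (upTo l) (λ _ → refl)) ⟩
  ψ 0 + 0                             ≡⟨ +-identityʳ (ψ 0) ⟩
  ψ 0                                 ∎)
  where open ≡-Reasoning
∑shapes-binomial (suc N) zero    ψ = cong₂ _+_ (∑shapes-zero N) (∑shapes-zero N)
∑shapes-binomial (suc N) (suc l) ψ =
  trans (cong₂ _+_ (∑shapes-binomial N l (ψ ∘ suc)) (∑shapes-binomial N (suc l) ψ))
        (∑-pascal N l ψ)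

-- admissible a b s: no true in s has at least a falses before it and at least b falses after it.
admissible : ℕ → ℕ → List Bool → Bool
admissible a       b []          = true
admissible (suc a) b (false ∷ s) = admissible a b s
admissible zero    b (false ∷ s) = admissible zero b s
admissible (suc a) b (true ∷ s)  = admissible (suc a) b s
admissible zero    b (true ∷ s)  = (zeros s <ᵇ b) ∧ admissible zero b s

zeros<⇒admissible : ∀ b s → T (zeros s <ᵇ b) → T (admissible zero b s)
zeros<⇒admissible b []          _ = _
zeros<⇒admissible b (false ∷ s) p = zeros<⇒admissible b s (<⇒<ᵇ (<-trans (n<1+n (zeros s)) (<ᵇ⇒< _ b p)))
zeros<⇒admissible b (true ∷ s)  p = from T-∧ (p , zeros<⇒admissible b s p)

admissible-suc : ∀ a b bs → T (admissible a b bs) → T (admissible (suc a) b bs)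
admissible-suc a       b []           _   = _
admissible-suc (suc a) b (false ∷ bs) adm = admissible-suc a b bs adm
admissible-suc zero    b (false ∷ bs) adm = adm
admissible-suc (suc a) b (true ∷ bs)  adm = admissible-suc (suc a) b bs adm
admissible-suc zero    b (true ∷ bs)  adm = admissible-suc zero b bs (proj₂ (to T-∧ adm))

replicate-false-⊆⇒≤zeros : ∀ b {bs} → replicate b false ⊆ bs → b ≤ zeros bs
replicate-false-⊆⇒≤zeros zero    _              = z≤n
replicate-false-⊆⇒≤zeros (suc b) (false ∷ʳ sub) = m≤n⇒m≤1+n (replicate-false-⊆⇒≤zeros (suc b) sub)
replicate-false-⊆⇒≤zeros (suc b) (true ∷ʳ sub)  = replicate-false-⊆⇒≤zeros (suc b) sub
replicate-false-⊆⇒≤zeros (suc b) (refl ∷ sub)   = s≤s (replicate-false-⊆⇒≤zeros b sub)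

≤zeros⇒replicate-false-⊆ : ∀ b bs → b ≤ zeros bs → replicate b false ⊆ bs
≤zeros⇒replicate-false-⊆ zero    bs           _         = minimum bs
≤zeros⇒replicate-false-⊆ (suc b) (false ∷ bs) (s≤s b≤) = refl ∷ ≤zeros⇒replicate-false-⊆ b bs b≤
≤zeros⇒replicate-false-⊆ (suc b) (true ∷ bs)  b≤       = true ∷ʳ ≤zeros⇒replicate-false-⊆ (suc b) bs b≤

inadmissible⇒motif-⊆ : ∀ a b bs → ¬ T (admissible a b bs) → motif a b false true ⊆ bs
inadmissible⇒motif-⊆ a       b []           ¬adm = ⊥-elim (¬adm _)
inadmissible⇒motif-⊆ (suc a) b (false ∷ bs) ¬adm = refl ∷ inadmissible⇒motif-⊆ a b bs ¬adm
inadmissible⇒motif-⊆ zero    b (false ∷ bs) ¬adm = false ∷ʳ inadmissible⇒motif-⊆ zero b bs ¬adm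
inadmissible⇒motif-⊆ (suc a) b (true ∷ bs)  ¬adm = true ∷ʳ inadmissible⇒motif-⊆ (suc a) b bs ¬adm
inadmissible⇒motif-⊆ zero    b (true ∷ bs)  ¬adm with zeros bs <ᵇ b | <ᵇ-reflects-< (zeros bs) b
... | true  | _        = true ∷ʳ inadmissible⇒motif-⊆ zero b bs ¬adm
... | false | ofⁿ z≮b = refl ∷ ≤zeros⇒replicate-false-⊆ b bs (≮⇒≥ z≮b)

motif-⊆⇒inadmissible : ∀ a b {bs} → motif a b false true ⊆ bs → ¬ T (admissible a b bs)
motif-⊆⇒inadmissible (suc a) b (refl ∷ sub)         = motif-⊆⇒inadmissible a b sub
motif-⊆⇒inadmissible zero    b (refl ∷ sub)     adm =
  <⇒≱ (<ᵇ⇒< _ b (proj₁ (to T-∧ adm))) (replicate-false-⊆⇒≤zeros b sub)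
motif-⊆⇒inadmissible (suc a) b {_ ∷ bs} (false ∷ʳ sub) adm =
  motif-⊆⇒inadmissible (suc a) b sub (admissible-suc a b bs adm)
motif-⊆⇒inadmissible zero    b (false ∷ʳ sub)       = motif-⊆⇒inadmissible zero b sub
motif-⊆⇒inadmissible (suc a) b (true ∷ʳ sub)        = motif-⊆⇒inadmissible (suc a) b sub
motif-⊆⇒inadmissible zero    b (true ∷ʳ sub)    adm =
  motif-⊆⇒inadmissible zero b sub (proj₂ (to T-∧ adm))

∑admissible : ℕ → ℕ → ℕ → (ℕ → ℕ) → ℕ
∑admissible m l N φ = ∑shapes N (λ s → if admissible m l s then φ (ones s) else 0)

∑admissible-zero-suc : ∀ l n (φ : ℕ → ℕ) →
  ∑admissible 0 l (suc n) φ ≡ ∑admissible 0 l n φ + (∑[ j ∈ upTo l ] (n C j) * φ (suc n ∸ j))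
∑admissible-zero-suc l n φ = cong (∑admissible 0 l n φ +_) (begin
  ∑shapes n (λ s → if (zeros s <ᵇ l) ∧ admissible 0 l s then φ (suc (ones s)) else 0)
    ≡⟨ ∑shapes-cong n few-zeros ⟩
  ∑shapes n (λ s → if zeros s <ᵇ l then φ (suc n ∸ zeros s) else 0)
    ≡⟨ ∑shapes-binomial n l (λ z → φ (suc n ∸ z)) ⟩
  ∑[ j ∈ upTo l ] (n C j) * φ (suc n ∸ j) ∎)
  where
  open ≡-Reasoning
  few-zeros : ∀ s → length s ≡ n →
    (if (zeros s <ᵇ l) ∧ admissible 0 l s then φ (suc (ones s)) else 0)
      ≡ (if zeros s <ᵇ l then φ (suc n ∸ zeros s) else 0)
  few-zeros s refl with zeros s <ᵇ l in z<l
  ... | false = refl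
  ... | true rewrite to T-≡ (zeros<⇒admissible l s (subst T (sym z<l) _)) =
    cong φ (suc-ones≡∸zeros s)

∑admissible-suc : ∀ m l n (φ : ℕ → ℕ) →
  ∑admissible m l (suc n) φ ≡ ∑admissible m l n φ + (∑[ j ∈ upTo (m + l) ] (n C j) * φ (suc n ∸ j))
∑admissible-suc zero    l n       φ = ∑admissible-zero-suc l n φ
∑admissible-suc (suc a) l zero    φ = cong (φ 0 +_) (sym (begin
  (∑[ j ∈ upTo (suc a + l) ] (0 C j) * φ (1 ∸ j))
    ≡⟨ ∑-upTo-suc (a + l) (λ j → (0 C j) * φ (1 ∸ j)) ⟩
  φ 1 + 0 + (∑[ j ∈ upTo (a + l) ] 0)
    ≡⟨ cong (φ 1 + 0 +_) (∑-zero (upTo (a + l)) (λ _ → refl)) ⟩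
  φ 1 + 0 + 0
    ≡⟨ trans (+-identityʳ _) (+-identityʳ (φ 1)) ⟩
  φ 1 ∎))
  where open ≡-Reasoning
-- The left side unfolds by the first letter of the shape.
∑admissible-suc (suc a) l (suc n) φ = begin
  ∑admissible a l (suc n) φ + ∑admissible (suc a) l (suc n) (φ ∘ suc)
    ≡⟨ cong₂ _+_ (∑admissible-suc a l n φ) (∑admissible-suc (suc a) l n (φ ∘ suc)) ⟩
  (∑admissible a l n φ + S₁) + (∑admissible (suc a) l n (φ ∘ suc) + S₂)
    ≡⟨ interchange (∑admissible a l n φ) S₁ _ S₂ ⟩
  F + (S₁ + S₂)
    ≡⟨ cong (λ S → F + (S₁ + S)) (∑-cong (upTo (suc a + l)) (λ j → C-*-suc-∸ n j φ)) ⟩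
  F + (S₁ + (∑[ j ∈ upTo (suc a + l) ] (n C j) * φ (suc (suc n) ∸ j)))
    ≡⟨ cong (F +_) (∑-pascal n (a + l) (λ j → φ (suc (suc n) ∸ j))) ⟩
  F + (∑[ j ∈ upTo (suc a + l) ] (suc n C j) * φ (suc (suc n) ∸ j)) ∎
  where
  open ≡-Reasoning
  F = ∑admissible (suc a) l (suc n) φ
  S₁ = ∑[ j ∈ upTo (a + l) ] (n C j) * φ (suc n ∸ j)
  S₂ = ∑[ j ∈ upTo (suc a + l) ] (n C j) * φ (suc (suc n ∸ j))

count : (A → Bool) → List A → ℕ
count p xs = length (filterᵇ p xs)

count-++ : ∀ (p : A → Bool) xs ys → count p (xs ++ ys) ≡ count p xs + count p ys
count-++ p xs ys = trans (cong length (filter-++ (T? ∘ p) xs ys)) (length-++ (filterᵇ p xs))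

count-cong : ∀ {p q : A → Bool} xs → (∀ x → p x ≡ q x) → count p xs ≡ count q xs
count-cong []       p≗q = refl
count-cong {p = p} {q = q} (x ∷ xs) p≗q with p x | q x | p≗q x
... | true  | true  | refl = cong suc (count-cong xs p≗q)
... | false | false | refl = count-cong xs p≗q

count-none : ∀ {p : A → Bool} xs → (∀ x → p x ≡ false) → count p xs ≡ 0
count-none {p = p} xs p≗false =
  cong length (filter-none (T? ∘ p) (All.universal (subst T ∘ p≗false) xs))

count-map : ∀ (p : B → Bool) (g : A → B) xs → count p (map g xs) ≡ count (p ∘ g) xs
count-map p g []       = refl
count-map p g (x ∷ xs) with p (g x)
... | true  = cong suc (count-map p g xs)
... | false = count-map p g xs

count-concatMap : ∀ (p : B → Bool) (g : A → List B) xs →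
  count p (concatMap g xs) ≡ ∑[ x ∈ xs ] count p (g x)
count-concatMap p g []       = refl
count-concatMap p g (x ∷ xs) =
  trans (count-++ p (g x) (concatMap g xs)) (cong (count p (g x) +_) (count-concatMap p g xs))

count-words-suc : ∀ k n (p : List (Fin k) → Bool) →
  count p (words k (suc n)) ≡ ∑[ i ∈ allFin k ] count (p ∘ (i ∷_)) (words k n)
count-words-suc k n p = trans (count-concatMap p _ (allFin k))
  (∑-cong (allFin k) (λ i → count-map p (i ∷_) (words k n)))

module _ {k : ℕ} where

  shape : List (Fin (suc k)) → List Bool
  shape = map ((0 <ᵇ_) ∘ toℕ)

  strip : List (Fin (suc k)) → List (Fin k)
  strip []          = []
  strip (zero ∷ σ)  = strip σ
  strip (suc i ∷ σ) = i ∷ strip σ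

count-by-shape : ∀ k N (q : List Bool → Bool) (p : List (Fin k) → Bool) →
  count (λ σ → q (shape σ) ∧ p (strip σ)) (words (suc k) N)
    ≡ ∑shapes N (λ s → if q s then count p (words k (ones s)) else 0)
count-by-shape k zero q p with q [] | p []
... | true  | true  = refl
... | true  | false = refl
... | false | _     = refl
count-by-shape k (suc N) q p = begin
  count r (words (suc k) (suc N))
    ≡⟨ count-words-suc (suc k) N r ⟩
  ∑[ i ∈ allFin (suc k) ] count (r ∘ (i ∷_)) (words (suc k) N)
    ≡⟨ ∑-allFin-suc k _ ⟩
  count (r ∘ (zero ∷_)) (words (suc k) N)
    + (∑[ i ∈ allFin k ] count (r ∘ (suc i ∷_)) (words (suc k) N))
    ≡⟨ cong₂ _+_ (count-by-shape k N (q ∘ (false ∷_)) p)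
                 (∑-cong (allFin k) (λ i → count-by-shape k N (q ∘ (true ∷_)) (p ∘ (i ∷_)))) ⟩
  S₀ + (∑[ i ∈ allFin k ] ∑shapes N (S₁ i))
    ≡⟨ cong (S₀ +_) (∑-∑shapes-comm (allFin k) N S₁) ⟩
  S₀ + ∑shapes N (λ s → ∑[ i ∈ allFin k ] S₁ i s)
    ≡⟨ cong (S₀ +_) (∑shapes-cong N (λ s _ → trans (∑-if (allFin k) (q (true ∷ s)) _)
         (cong (λ c → if q (true ∷ s) then c else 0) (sym (count-words-suc k (ones s) p))))) ⟩
  ∑shapes (suc N) (λ s → if q s then count p (words k (ones s)) else 0) ∎
  where
  open ≡-Reasoning
  r : List (Fin (suc k)) → Bool
  r σ = q (shape σ) ∧ p (strip σ)
  S₀ = ∑shapes N (λ s → if q (false ∷ s) then count p (words k (ones s)) else 0)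
  S₁ : Fin k → List Bool → ℕ
  S₁ i s = if q (true ∷ s) then count (p ∘ (i ∷_)) (words k (ones s)) else 0

Any-subseqs⁺ : ∀ {P : List A → Set} {ys xs} → ys ⊆ xs → P ys → Any P (subseqs xs)
Any-subseqs⁺                 []           p = here p
Any-subseqs⁺ {xs = x ∷ xs}   (_ ∷ʳ sub)   p =
  Any.++⁺ʳ (map (x ∷_) (subseqs xs)) (Any-subseqs⁺ sub p)
Any-subseqs⁺ {P = P}         (refl ∷ sub) p =
  Any.++⁺ˡ (Any.map⁺ (Any-subseqs⁺ {P = P ∘ (_ ∷_)} sub p))

Any-subseqs⁻ : ∀ {P : List A → Set} xs → Any P (subseqs xs) → ∃[ ys ] ys ⊆ xs × P ys
Any-subseqs⁻ []       (here p) = [] , [] , p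
Any-subseqs⁻ (x ∷ xs) any with Any.++⁻ (map (x ∷_) (subseqs xs)) any
... | inj₁ any-x∷ with Any-subseqs⁻ xs (Any.map⁻ any-x∷)
...   | ys , ys⊆xs , p = x ∷ ys , refl ∷ ys⊆xs , p
Any-subseqs⁻ (x ∷ xs) any | inj₂ any-xs with Any-subseqs⁻ xs any-xs
...   | ys , ys⊆xs , p = ys , x ∷ʳ ys⊆xs , p

⊆-map⁻ : ∀ (f : A → B) {ys} xs → ys ⊆ map f xs → ∃[ zs ] zs ⊆ xs × map f zs ≡ ys
⊆-map⁻ f []       []           = [] , [] , refl
⊆-map⁻ f (x ∷ xs) (_ ∷ʳ sub)   with ⊆-map⁻ f xs sub
... | zs , zs⊆xs , refl = zs , x ∷ʳ zs⊆xs , refl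
⊆-map⁻ f (x ∷ xs) (refl ∷ sub) with ⊆-map⁻ f xs sub
... | zs , zs⊆xs , refl = x ∷ zs , refl ∷ zs⊆xs , refl

cmp-refl : ∀ a → cmp a a ≡ eq
cmp-refl a with a <ᵇ a | <ᵇ-reflects-< a a | a ≡ᵇ a | ≡⇒≡ᵇ a a refl
... | true  | ofʸ a<a | _    | _ = ⊥-elim (n≮n a a<a)
... | false | _       | true | _ = refl

cmp-< : ∀ {a b} → a < b → cmp a b ≡ lt
cmp-< a<b rewrite to T-≡ (<⇒<ᵇ a<b) = refl

cmp-> : ∀ {a b} → a < b → cmp b a ≡ gt
cmp-> {a} {b} a<b with b <ᵇ a | <ᵇ-reflects-< b a | b ≡ᵇ a | ≡ᵇ⇒≡ b a
... | true  | ofʸ b<a | _     | _   = ⊥-elim (<-asym a<b b<a)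
... | false | _       | true  | b≡a = ⊥-elim (<-irrefl (sym (b≡a _)) a<b)
... | false | _       | false | _   = refl

cmp≡lt⇒< : ∀ {a b} → cmp a b ≡ lt → a < b
cmp≡lt⇒< {a} {b} e with a <ᵇ b | <ᵇ-reflects-< a b | a ≡ᵇ b
... | true  | ofʸ a<b | _ = a<b
cmp≡lt⇒< () | false | _ | true
cmp≡lt⇒< () | false | _ | false

cmp≡eq⇒≡ : ∀ {a b} → cmp a b ≡ eq → a ≡ b
cmp≡eq⇒≡ {a} {b} e with a <ᵇ b | a ≡ᵇ b | ≡ᵇ⇒≡ a b
... | false | true | a≡b = a≡b _
cmp≡eq⇒≡ () | true  | _     | _
cmp≡eq⇒≡ () | false | false | _

T-sameRel : ∀ {r r'} → T (sameRel r r') → r ≡ r'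
T-sameRel {lt} {lt} _ = refl
T-sameRel {eq} {eq} _ = refl
T-sameRel {gt} {gt} _ = refl
T-sameRel {lt} {eq} ()
T-sameRel {lt} {gt} ()
T-sameRel {eq} {lt} ()
T-sameRel {eq} {gt} ()
T-sameRel {gt} {lt} ()
T-sameRel {gt} {eq} ()

-- Definitionally equal to the local pairOK of orderIso (matching on a pair is by projections),
-- so the rows of the comparison table in orderIso can be stated through it.
agree : ℕ × ℕ → ℕ × ℕ → Bool
agree (x , a) (y , b) = sameRel (cmp x y) (cmp a b)

orderIso-v⁺ : ∀ m l {a b} → a < b → T (orderIso (motif m l a b) (v m l))
orderIso-v⁺ m l {a} {b} a<b = from T-∧
  ( ≡⇒≡ᵇ _ _ (trans (length-motif m l a b) (sym (length-motif m l 1 2)))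
  , subst (λ qs → T (all (λ p → all (agree p) qs) qs)) (sym (zip-motif m l a b 1 2))
      (all-motif _ m l (all-motif _ m l (agrees-with-itself a) a-b)
                       (all-motif _ m l b-a (agrees-with-itself b))))
  where
  agrees-with-itself : ∀ x → T (sameRel (cmp x x) eq)
  agrees-with-itself x rewrite cmp-refl x = _
  a-b : T (sameRel (cmp a b) lt)
  a-b rewrite cmp-< a<b = _
  b-a : T (sameRel (cmp b a) gt)
  b-a rewrite cmp-> a<b = _

module _ {a : ℕ} where

  row-replicate : ∀ l ps → length ps ≡ l → T (all (agree (a , 1)) (zip ps (replicate l 1))) →
    ps ≡ replicate l a
  row-replicate zero    []       _   _   = refl
  row-replicate (suc l) (x ∷ ps) len row with to T-∧ row
  ... | a~x , rest =
    cong₂ _∷_ (sym (cmp≡eq⇒≡ (T-sameRel a~x))) (row-replicate l ps (suc-injective len) rest)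

  row-motif : ∀ m l ps → length ps ≡ m + suc l → T (all (agree (a , 1)) (zip ps (motif m l 1 2))) →
    ∃[ b ] a < b × ps ≡ motif m l a b
  row-motif (suc m) l (x ∷ ps) len row with to T-∧ row
  ... | a~x , rest with row-motif m l ps (suc-injective len) rest
  ...   | b , a<b , ps≡ = b , a<b , cong₂ _∷_ (sym (cmp≡eq⇒≡ (T-sameRel a~x))) ps≡
  row-motif zero    l (y ∷ ps) len row with to T-∧ row
  ... | a~y , rest =
    y , cmp≡lt⇒< (T-sameRel a~y) , cong (y ∷_) (row-replicate l ps (suc-injective len) rest)

orderIso⇒rows : ∀ s t → T (orderIso s t) →
  length s ≡ length t × All (λ p → T (all (agree p) (zip s t))) (zip s t)
orderIso⇒rows s t iso = ≡ᵇ⇒≡ _ _ (proj₁ parts) , all⁺ _ _ (proj₂ parts)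
  where parts = to T-∧ iso

-- The repeated letter a is read off the row of a position where v m l has a 1.
orderIso-v⁻ : ∀ m l ps → 1 ≤ m + l → T (orderIso ps (v m l)) → ∃₂ λ a b → a < b × ps ≡ motif m l a b
orderIso-v⁻ (suc m) l ps@(a ∷ _) _ iso with orderIso⇒rows ps (v (suc m) l) iso
... | len , a-row ∷ _ = a , row-motif (suc m) l ps (trans len (length-motif (suc m) l 1 2)) a-row
orderIso-v⁻ zero (suc l) ps@(_ ∷ a ∷ _) _ iso with orderIso⇒rows ps (v zero (suc l)) iso
... | len , _ ∷ a-row ∷ _ =
  a , row-motif zero (suc l) ps (trans len (length-motif zero (suc l) 1 2)) a-row
orderIso-v⁻ (suc m) l    []      _ ()
orderIso-v⁻ zero (suc l) []      _ ()
orderIso-v⁻ zero (suc l) (_ ∷ []) _ ()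

module _ {k : ℕ} (σ : List (Fin k)) (τ : List ℕ) where

  contains⁺ : ∀ {ps} → ps ⊆ map toℕ σ → T (orderIso ps τ) → T (contains σ τ)
  contains⁺ ps⊆σ iso with ⊆-map⁻ toℕ σ ps⊆σ
  ... | s , s⊆σ , refl = Any.any⁺ _ (Any-subseqs⁺ s⊆σ iso)

  contains⁻ : T (contains σ τ) → ∃[ ps ] ps ⊆ map toℕ σ × T (orderIso ps τ)
  contains⁻ c with Any-subseqs⁻ σ (Any.any⁻ _ _ c)
  ... | s , s⊆σ , iso = map toℕ s , map⁺ toℕ s⊆σ , iso

-- Occurrences of v_{m,l} and the smallest letter

module _ {k : ℕ} where

  shape-toℕ : ∀ (σ : List (Fin (suc k))) → shape σ ≡ map (0 <ᵇ_) (map toℕ σ)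
  shape-toℕ = map-∘

  strip-⊆⁺ : ∀ {ps} (σ : List (Fin (suc k))) → ps ⊆ map toℕ (strip σ) → map suc ps ⊆ map toℕ σ
  strip-⊆⁺ []          []           = []
  strip-⊆⁺ (zero ∷ σ)  sub          = 0 ∷ʳ strip-⊆⁺ σ sub
  strip-⊆⁺ (suc i ∷ σ) (_ ∷ʳ sub)   = _ ∷ʳ strip-⊆⁺ σ sub
  strip-⊆⁺ (suc i ∷ σ) (refl ∷ sub) = refl ∷ strip-⊆⁺ σ sub

  strip-⊆⁻ : ∀ ps (σ : List (Fin (suc k))) → map suc ps ⊆ map toℕ σ → ps ⊆ map toℕ (strip σ)
  strip-⊆⁻ []       σ           _            = minimum _
  strip-⊆⁻ (p ∷ ps) (zero ∷ σ)  (_ ∷ʳ sub)   = strip-⊆⁻ (p ∷ ps) σ sub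
  strip-⊆⁻ (p ∷ ps) (suc i ∷ σ) (_ ∷ʳ sub)   = _ ∷ʳ strip-⊆⁻ (p ∷ ps) σ sub
  strip-⊆⁻ (p ∷ ps) (suc i ∷ σ) (refl ∷ sub) = refl ∷ strip-⊆⁻ ps σ sub

replicate-positivity⁻ : ∀ l ps → map (0 <ᵇ_) ps ≡ replicate l false → ps ≡ replicate l 0
replicate-positivity⁻ zero    []          _ = refl
replicate-positivity⁻ (suc l) (zero ∷ ps) e =
  cong (0 ∷_) (replicate-positivity⁻ l ps (∷-injectiveʳ e))

motif-positivity⁻ : ∀ m l ps → map (0 <ᵇ_) ps ≡ motif m l false true →
  ∃[ b ] 0 < b × ps ≡ motif m l 0 b
motif-positivity⁻ (suc m) l (zero ∷ ps)  e with motif-positivity⁻ m l ps (∷-injectiveʳ e)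
... | b , 0<b , refl = b , 0<b , refl
motif-positivity⁻ zero    l (suc b ∷ ps) e =
  suc b , z<s , cong (suc b ∷_) (replicate-positivity⁻ l ps (∷-injectiveʳ e))

module _ {k : ℕ} (m l : ℕ) (σ : List (Fin (suc k))) where

  inadmissible⇒contains : ¬ T (admissible m l (shape σ)) → T (contains σ (v m l))
  inadmissible⇒contains ¬adm
    with ⊆-map⁻ (0 <ᵇ_) (map toℕ σ)
           (subst (motif m l false true ⊆_) (shape-toℕ σ) (inadmissible⇒motif-⊆ m l (shape σ) ¬adm))
  ... | ps , ps⊆σ , ps-shape with motif-positivity⁻ m l ps ps-shape
  ...   | b , 0<b , refl = contains⁺ σ (v m l) ps⊆σ (orderIso-v⁺ m l 0<b)

  strip-contains⇒contains : 1 ≤ m + l → T (contains (strip σ) (v m l)) → T (contains σ (v m l))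
  strip-contains⇒contains pos c with contains⁻ (strip σ) (v m l) c
  ... | ps , ps⊆strip , iso with orderIso-v⁻ m l ps pos iso
  ...   | a , b , a<b , refl = contains⁺ σ (v m l)
    (subst (_⊆ map toℕ σ) (map-motif suc m l a b) (strip-⊆⁺ σ ps⊆strip)) (orderIso-v⁺ m l (s<s a<b))

  contains⇒inadmissible⊎strip-contains : 1 ≤ m + l → T (contains σ (v m l)) →
    ¬ T (admissible m l (shape σ)) ⊎ T (contains (strip σ) (v m l))
  contains⇒inadmissible⊎strip-contains pos c with contains⁻ σ (v m l) c
  ... | ps , ps⊆σ , iso with orderIso-v⁻ m l ps pos iso
  ...   | zero , suc b , _ , refl = inj₁ (motif-⊆⇒inadmissible m l
    (subst₂ _⊆_ (map-motif (0 <ᵇ_) m l 0 (suc b)) (sym (shape-toℕ σ)) (map⁺ (0 <ᵇ_) ps⊆σ)))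
  ...   | suc a , suc b , s<s a<b , refl = inj₂ (contains⁺ (strip σ) (v m l)
    (strip-⊆⁻ (motif m l a b) σ (subst (_⊆ map toℕ σ) (sym (map-motif suc m l a b)) ps⊆σ))
    (orderIso-v⁺ m l a<b))

not-≡-∧-not : ∀ {c a d} → (T c → ¬ T a ⊎ T d) → (¬ T a → T c) → (T d → T c) → not c ≡ a ∧ not d
not-≡-∧-not {true}  {false}         _     _   _ = refl
not-≡-∧-not {true}  {true}  {true}  _     _   _ = refl
not-≡-∧-not {true}  {true}  {false} split _   _ with split _
... | inj₁ ¬a = ⊥-elim (¬a _)
... | inj₂ ()
not-≡-∧-not {false} {false}         _     ¬a⇒ _ = ⊥-elim (¬a⇒ (λ ()))
not-≡-∧-not {false} {true}  {true}  _     _   d⇒ = ⊥-elim (d⇒ _)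
not-≡-∧-not {false} {true}  {false} _     _   _ = refl

avoids-v≡admissible∧strip-avoids : ∀ {k} m l (σ : List (Fin (suc k))) → 1 ≤ m + l →
  not (contains σ (v m l)) ≡ admissible m l (shape σ) ∧ not (contains (strip σ) (v m l))
avoids-v≡admissible∧strip-avoids m l σ pos = not-≡-∧-not
  (contains⇒inadmissible⊎strip-contains m l σ pos)
  (inadmissible⇒contains m l σ)
  (strip-contains⇒contains m l σ pos)

f-by-shape : ∀ m l k N → 1 ≤ m + l → f (v m l) N (suc k) ≡ ∑admissible m l N (λ r → f (v m l) r k)
f-by-shape m l k N pos =
  trans (count-cong (words (suc k) N) (λ σ → avoids-v≡admissible∧strip-avoids m l σ pos))
        (count-by-shape k N (admissible m l) (λ τ → not (contains τ (v m l))))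

contains-v00 : ∀ {k} (i : Fin k) σ → T (contains (i ∷ σ) (v 0 0))
contains-v00 i σ = contains⁺ (i ∷ σ) (v 0 0) (refl ∷ minimum _) iso
  where
  iso : T (orderIso (toℕ i ∷ []) (2 ∷ []))
  iso rewrite cmp-refl (toℕ i) = _

f-v00 : ∀ k N → f (v 0 0) (suc N) (suc k) ≡ 0
f-v00 k N = trans (count-words-suc (suc k) N _) (∑-zero (allFin (suc k)) (λ i →
  count-none (words (suc k) N) (λ σ → cong not (to T-≡ (contains-v00 i σ)))))

f-recurrence : ∀ m l k n → 1 ≤ m + l →
  f (v m l) (suc n) (suc k)
    ≡ f (v m l) n (suc k) + (∑[ j ∈ upTo (m + l) ] (n C j) * f (v m l) (suc n ∸ j) k)
f-recurrence m l k n pos = begin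
  f (v m l) (suc n) (suc k)    ≡⟨ f-by-shape m l k (suc n) pos ⟩
  ∑admissible m l (suc n) φ    ≡⟨ ∑admissible-suc m l n φ ⟩
  ∑admissible m l n φ + S      ≡⟨ cong (_+ S) (f-by-shape m l k n pos) ⟨
  f (v m l) n (suc k) + S      ∎
  where
  open ≡-Reasoning
  φ = λ r → f (v m l) r k
  S = ∑[ j ∈ upTo (m + l) ] (n C j) * φ (suc n ∸ j)

theorem13 : (m l k : ℕ) → 1 ≤ k → (n : ℕ) → 1 ≤ n →
    f (v m l) (n + 1) k ≡
      f (v m l) n k + sum (map (λ j → (n C j) * f (v m l) (n + 1 ∸ j) (k ∸ 1)) (upTo (m + l)))
theorem13 (suc m) l       (suc k) _ n       _ rewrite +-comm n 1 = f-recurrence (suc m) l k n z<s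
theorem13 zero    (suc l) (suc k) _ n       _ rewrite +-comm n 1 = f-recurrence zero (suc l) k n z<s
theorem13 zero    zero    (suc k) _ (suc n) _ rewrite +-comm n 1 =
  trans (f-v00 k (suc n)) (sym (trans (+-identityʳ _) (f-v00 k n)))
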